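{- For every simple connected graph $G=(V,E)$, $\lfloor d(G) + 1 \rfloor \leq \left\lfloor \frac{3 + \sqrt{9 + 8(|E| - |V|)}}{2} \right\rfloor$.
   Context: All graphs are finite, simple and undirected. The average degree of $G$ is $d(G)=\frac{2|E|}{|V|}$ if $V\neq\emptyset$ and $d(G)=0$ for the null graph. -}

module Defs where

open import Data.Nat as ℕ using (ℕ; zero; suc)
open import Data.Fin using (Fin) renaming (_<_ to _<ᶠ_)
open import Data.Product using (_×_; _,_)
open import Data.Sum using (_⊎_)
open import Data.List using (List; length)
open import Data.List.Relation.Unary.All using (All)
open import Data.List.Relation.Unary.Unique.Propositional using (Unique)
open import Data.List.Membership.Propositional using (_∈_)
open import Data.Integer as ℤ using (ℤ; +_)
open import Data.Rational as ℚ using (ℚ; 0ℚ; 1ℚ)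

-- Each edge {i,j} is stored exactly once as an ordered pair (i , j) with i < j,
-- so there are no loops, no multi-edges, and |E| = length of the edge list.
record Graph (n : ℕ) : Set where
  field
    edges   : List (Fin n × Fin n)
    ordered : All (λ e → Data.Product.proj₁ e <ᶠ Data.Product.proj₂ e) edges
    unique  : Unique edges

open Graph public

numV : ∀ {n} → Graph n → ℕ
numV {n} _ = n

numE : ∀ {n} → Graph n → ℕ
numE G = length (edges G)

Adj : ∀ {n} → Graph n → Fin n → Fin n → Set
Adj G u v = ((u , v) ∈ edges G) ⊎ ((v , u) ∈ edges G)

data Reach {n : ℕ} (G : Graph n) : Fin n → Fin n → Set where
  here : ∀ {u} → Reach G u u
  step : ∀ {u w v} → Adj G u w → Reach G w v → Reach G u v

Connected : ∀ {n} → Graph n → Set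
Connected {n} G = (u v : Fin n) → Reach G u v

avgDeg : ∀ {n} → Graph n → ℚ
avgDeg {zero}  G = 0ℚ
avgDeg {suc k} G = (+ (2 ℕ.* numE G)) ℚ./ (suc k)

-- Integer encodings of comparisons with √D (D ≥ 0), for integers a, b:
--   a ≤ √D   iff   a ≤ 0  or  a² ≤ D
--   √D < b   iff   0 < b  and D < b²
LeSqrt : ℤ → ℤ → Set
LeSqrt a D = (a ℤ.≤ + 0) ⊎ (a ℤ.* a ℤ.≤ D)

SqrtLt : ℤ → ℤ → Set
SqrtLt D b = (+ 0 ℤ.< b) × (D ℤ.< b ℤ.* b)

-- IsFloorHalf3PlusSqrt D k  :⇔  D ≥ 0 and k = ⌊ (3 + √D) / 2 ⌋,
-- i.e.  k ≤ (3 + √D)/2 < k + 1,  i.e.  2k - 3 ≤ √D < 2k - 1.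
IsFloorHalf3PlusSqrt : ℤ → ℤ → Set
IsFloorHalf3PlusSqrt D k =
  (+ 0 ℤ.≤ D) × LeSqrt (+ 2 ℤ.* k ℤ.- + 3) D × SqrtLt D (+ 2 ℤ.* k ℤ.- + 1)

-- Write m = |E|, n = |V|, Δ = 9 + 8(m - n) and k for the right-hand side; it suffices
-- that 2m < kn, i.e. d(G) < k. From √Δ < 2k - 1 one gets 2m + 2 < 2n + k(k - 1).
-- If n ≤ k, then 2m ≤ n(n - 1) < kn. Otherwise (k - 2)(n - k - 1) ≥ 0 gives
-- 2n + k(k - 1) ≤ kn + 2, except for k = 1, which is impossible: Δ ≥ 0 forces
-- n ≤ m + 1, against 2m + 2 < 2n.
module Submission where

open import Defs
open import Function using (_∘_)
open import Function.Definitions using (Injective)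
open import Data.Empty using (⊥-elim)
open import Data.Product using (_×_; _,_; proj₁; proj₂; swap; uncurry)
open import Data.Nat as ℕ using (ℕ; zero; suc; _≤_; _<_; z≤n; s≤s; z<s)
import Data.Nat.Properties as ℕ
open import Data.Nat.Tactic.RingSolver as ℕSolver using ()
open import Data.Fin as Fin using (Fin; combine)
import Data.Fin.Properties as Fin
open import Data.List using (List; _∷_; length; lookup; map; _++_; allFin)
open import Data.List.Properties using (length-map; length-++; length-tabulate)
open import Data.List.Relation.Unary.All as All using (All)
import Data.List.Relation.Unary.All.Properties as All
open import Data.List.Relation.Unary.AllPairs using (_∷_)
open import Data.List.Relation.Unary.Unique.Propositional using (Unique)
import Data.List.Relation.Unary.Unique.Propositional.Properties as Unique
open import Data.List.Relation.Binary.Disjoint.Propositional using (Disjoint)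
open import Data.List.Membership.Propositional.Properties using (∈-lookup)
open import Data.Integer as ℤ using (ℤ; +_; +<+)
import Data.Integer.Properties as ℤ
open import Data.Integer.Tactic.RingSolver as ℤSolver using ()
open import Data.Integer.DivMod using ([n/d]*d≤n)
open import Data.Rational as ℚ using (1ℚ; toℚᵘ)
import Data.Rational.Properties as ℚ
open import Data.Rational.Unnormalised as ℚᵘ using (*<*; *≡*)
import Data.Rational.Unnormalised.Properties as ℚᵘ
open import Relation.Binary.PropositionalEquality
open import Relation.Nullary using (¬_; yes; no)

private
  variable
    A : Set

lookup-injective : {xs : List A} → Unique xs → Injective _≡_ _≡_ (lookup xs)
lookup-injective (_  ∷ _) {Fin.zero}  {Fin.zero}  _  = refl
lookup-injective (x∉ ∷ _) {Fin.zero}  {Fin.suc j} eq = ⊥-elim (All.lookup x∉ (∈-lookup j) eq)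
lookup-injective (x∉ ∷ _) {Fin.suc i} {Fin.zero}  eq = ⊥-elim (All.lookup x∉ (∈-lookup i) (sym eq))
lookup-injective (_  ∷ u) {Fin.suc i} {Fin.suc j} eq = cong Fin.suc (lookup-injective u eq)

Unique⇒length≤ : ∀ {N} {f : A → Fin N} {xs : List A} →
                 Injective _≡_ _≡_ f → Unique xs → length xs ≤ N
Unique⇒length≤ f-inj u = Fin.injective⇒≤ (lookup-injective u ∘ f-inj)

disjoint : {P Q : A → Set} {xs ys : List A} →
           (∀ {x} → P x → ¬ Q x) → All P xs → All Q ys → Disjoint xs ys
disjoint P⇒¬Q ps qs (x∈xs , x∈ys) = P⇒¬Q (All.lookup ps x∈xs) (All.lookup qs x∈ys)

combine-pair-injective : ∀ {m n} → Injective _≡_ _≡_ (uncurry (combine {m} {n}))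
combine-pair-injective {x = i , j} {y = k , l} eq with Fin.combine-injective i j k l eq
... | refl , refl = refl

-- The edges, the reversed edges and the loops are pairwise distinct ordered
-- pairs of vertices, so together they number at most n².
module _ {n} (G : Graph n) where
  private
    ascending : Fin n × Fin n → Set
    ascending (i , j) = i Fin.< j

    reversed diagonal : List (Fin n × Fin n)
    reversed = map swap (edges G)
    diagonal = map (λ i → i , i) (allFin n)

    reversed-descending : All (λ e → proj₂ e Fin.< proj₁ e) reversed
    reversed-descending = All.map⁺ (ordered G)

    diagonal-equal : All (λ e → proj₁ e ≡ proj₂ e) diagonal
    diagonal-equal = All.map⁺ (All.universal (λ _ → refl) (allFin n))

    others-not-ascending : All (¬_ ∘ ascending) (reversed ++ diagonal)
    others-not-ascending = All.++⁺ (All.map Fin.<-asym reversed-descending)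
                                   (All.map (λ eq → Fin.<-irrefl eq) diagonal-equal)

    unique-pairs : Unique (edges G ++ reversed ++ diagonal)
    unique-pairs = Unique.++⁺ (unique G)
      (Unique.++⁺ (Unique.map⁺ (cong swap) (unique G))
                  (Unique.map⁺ (cong proj₁) (Unique.allFin⁺ n))
                  (disjoint (λ j<i i≡j → Fin.<-irrefl (sym i≡j) j<i) reversed-descending diagonal-equal))
      (disjoint (λ i<j ¬i<j → ¬i<j i<j) (ordered G) others-not-ascending)

  2*numE+n≤n*n : 2 ℕ.* numE G ℕ.+ n ≤ n ℕ.* n
  2*numE+n≤n*n = subst (_≤ n ℕ.* n) pairs-length (Unique⇒length≤ combine-pair-injective unique-pairs)
    where
    open ≡-Reasoning
    pairs-length : length (edges G ++ reversed ++ diagonal) ≡ 2 ℕ.* numE G ℕ.+ n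
    pairs-length = begin
      length (edges G ++ reversed ++ diagonal)
        ≡⟨ length-++ (edges G) ⟩
      numE G ℕ.+ length (reversed ++ diagonal)
        ≡⟨ cong (numE G ℕ.+_) (length-++ reversed) ⟩
      numE G ℕ.+ (length reversed ℕ.+ length diagonal)
        ≡⟨ cong₂ (λ a b → numE G ℕ.+ (a ℕ.+ b)) (length-map swap (edges G))
                 (trans (length-map _ (allFin n)) (length-tabulate {n = n} (λ i → i))) ⟩
      numE G ℕ.+ (numE G ℕ.+ n)
        ≡⟨ ℕ.+-assoc (numE G) (numE G) n ⟨
      numE G ℕ.+ numE G ℕ.+ n
        ≡⟨ cong (λ a → numE G ℕ.+ a ℕ.+ n) (ℕ.+-identityʳ (numE G)) ⟨
      2 ℕ.* numE G ℕ.+ n ∎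

-- (t - 1)(n - t - 2) ≥ 0
2*n+t*[1+t]≤[1+t]*n+2 : ∀ {n t} → 1 ≤ t → suc t < n → 2 ℕ.* n ℕ.+ t ℕ.* suc t ≤ suc t ℕ.* n ℕ.+ 2
2*n+t*[1+t]≤[1+t]*n+2 {n} {suc s} _ t+1<n with ℕ.m≤n⇒∃[o]m+o≡n t+1<n
... | r , refl = ℕ.≤-trans (ℕ.m≤m+n _ (s ℕ.* r)) (ℕ.≤-reflexive (expand s r))
  where
  expand : ∀ s r → 2 ℕ.* (suc (suc (suc s)) ℕ.+ r) ℕ.+ suc s ℕ.* suc (suc s) ℕ.+ s ℕ.* r
                 ≡ suc (suc s) ℕ.* (suc (suc (suc s)) ℕ.+ r) ℕ.+ 2
  expand = ℕSolver.solve-∀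

2*m<[1+t]*n : ∀ {m n t} → 0 < n → n ≤ suc m → 2 ℕ.* m ℕ.+ 2 < 2 ℕ.* n ℕ.+ t ℕ.* suc t →
              2 ℕ.* m ℕ.+ n ≤ n ℕ.* n → 2 ℕ.* m < suc t ℕ.* n
2*m<[1+t]*n {m} {n} {zero} _ n≤1+m 2m+2<2n _ =
  ⊥-elim (ℕ.<⇒≱ 2m+2<2n (ℕ.≤-trans (ℕ.≤-reflexive (ℕ.+-identityʳ _)) 2n≤2m+2))
  where
  2n≤2m+2 : 2 ℕ.* n ≤ 2 ℕ.* m ℕ.+ 2
  2n≤2m+2 = ℕ.≤-trans (ℕ.*-monoʳ-≤ 2 n≤1+m) (ℕ.≤-reflexive (trans (ℕ.*-suc 2 m) (ℕ.+-comm 2 (2 ℕ.* m))))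
2*m<[1+t]*n {m} {n} {suc s} 0<n _ 2m+2<bound 2m+n≤n² with n ℕ.≤? suc (suc s)
... | yes n≤1+t = ℕ.<-≤-trans (ℕ.m<m+n (2 ℕ.* m) 0<n) (ℕ.≤-trans 2m+n≤n² (ℕ.*-monoˡ-≤ n n≤1+t))
... | no n≰1+t = ℕ.+-cancelʳ-< 2 (2 ℕ.* m) _
                   (ℕ.<-≤-trans 2m+2<bound (2*n+t*[1+t]≤[1+t]*n+2 (s≤s z≤n) (ℕ.≰⇒> n≰1+t)))

Δ : ℕ → ℕ → ℤ
Δ m n = + 9 ℤ.+ + 8 ℤ.* (+ m ℤ.- + n)

Δ+8*n≡9+8*m : ∀ m n → Δ m n ℤ.+ + (8 ℕ.* n) ≡ + (9 ℕ.+ 8 ℕ.* m)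
Δ+8*n≡9+8*m m n = begin
  Δ m n ℤ.+ + (8 ℕ.* n)     ≡⟨ cong (ℤ._+_ (Δ m n)) (ℤ.pos-* 8 n) ⟩
  Δ m n ℤ.+ + 8 ℤ.* + n     ≡⟨ cancel-n (+ m) (+ n) ⟩
  + 9 ℤ.+ + 8 ℤ.* + m       ≡⟨ cong (ℤ._+_ (+ 9)) (ℤ.pos-* 8 m) ⟨
  + (9 ℕ.+ 8 ℕ.* m)         ∎
  where
  open ≡-Reasoning
  cancel-n : ∀ (M N : ℤ) → + 9 ℤ.+ + 8 ℤ.* (M ℤ.- N) ℤ.+ + 8 ℤ.* N ≡ + 9 ℤ.+ + 8 ℤ.* M
  cancel-n = ℤSolver.solve-∀

0≤Δ⇒n≤1+m : ∀ {m n} → + 0 ℤ.≤ Δ m n → n ≤ suc m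
0≤Δ⇒n≤1+m {m} {n} 0≤Δ = ℕ.≤-pred (ℕ.*-cancelˡ-< 8 n (suc (suc m)) 8n<8[m+2])
  where
  8n≤9+8m : 8 ℕ.* n ≤ 9 ℕ.+ 8 ℕ.* m
  8n≤9+8m = ℤ.drop‿+≤+ (subst (+ (8 ℕ.* n) ℤ.≤_) (Δ+8*n≡9+8*m m n) (ℤ.+-monoˡ-≤ (+ (8 ℕ.* n)) 0≤Δ))
  8n<8[m+2] : 8 ℕ.* n < 8 ℕ.* suc (suc m)
  8n<8[m+2] = begin-strict
    8 ℕ.* n                    ≤⟨ 8n≤9+8m ⟩
    9 ℕ.+ 8 ℕ.* m              <⟨ ℕ.m<m+n _ {7} z<s ⟩
    9 ℕ.+ 8 ℕ.* m ℕ.+ 7        ≡⟨ expand m ⟩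
    8 ℕ.* suc (suc m)          ∎
    where
    open ℕ.≤-Reasoning
    expand : ∀ m → 9 ℕ.+ 8 ℕ.* m ℕ.+ 7 ≡ 8 ℕ.* suc (suc m)
    expand = ℕSolver.solve-∀

Δ<[2k-1]²⇒2*m+2<2*n+t*[1+t] : ∀ {m n t} → let 2k-1 = + 2 ℤ.* + suc t ℤ.- + 1 in
                              Δ m n ℤ.< 2k-1 ℤ.* 2k-1 → 2 ℕ.* m ℕ.+ 2 < 2 ℕ.* n ℕ.+ t ℕ.* suc t
Δ<[2k-1]²⇒2*m+2<2*n+t*[1+t] {m} {n} {t} Δ<[2k-1]² =
  ℕ.*-cancelˡ-< 4 _ _ (ℕ.+-cancelʳ-< 1 _ _ (subst₂ _<_ (lhs m) (rhs n t) 9+8m<a²+8n))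
  where
  -- the normal form of 2k - 1
  a : ℕ
  a = t ℕ.+ 1 ℕ.* suc t
  9+8m<a²+8n : 9 ℕ.+ 8 ℕ.* m < a ℕ.* a ℕ.+ 8 ℕ.* n
  9+8m<a²+8n = ℤ.drop‿+<+ (subst₂ ℤ._<_ (Δ+8*n≡9+8*m m n) (cong (ℤ._+ + (8 ℕ.* n)) (sym (ℤ.pos-* a a)))
                                   (ℤ.+-monoˡ-< (+ (8 ℕ.* n)) Δ<[2k-1]²))
  lhs : ∀ m → 9 ℕ.+ 8 ℕ.* m ≡ 4 ℕ.* (2 ℕ.* m ℕ.+ 2) ℕ.+ 1
  lhs = ℕSolver.solve-∀
  rhs : ∀ n t → (t ℕ.+ 1 ℕ.* suc t) ℕ.* (t ℕ.+ 1 ℕ.* suc t) ℕ.+ 8 ℕ.* n ≡ 4 ℕ.* (2 ℕ.* n ℕ.+ t ℕ.* suc t) ℕ.+ 1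
  rhs = ℕSolver.solve-∀

floor<⇒ : ∀ p {k} → toℚᵘ p ℚᵘ.< k ℚᵘ./ 1 → ℚ.floor p ℤ.< k
floor<⇒ p@record{} {k} (*<* ↥p<k↧p) = ℤ.*-cancelʳ-<-nonNeg (ℚ.↧ p) (ℤ.≤-<-trans
  ([n/d]*d≤n (ℚ.↥ p) (ℚ.↧ p)) (subst (ℤ._< k ℤ.* ℚ.↧ p) (ℤ.*-identityʳ (ℚ.↥ p)) ↥p<k↧p))

floor[p+1]≤ : ∀ p {k} → toℚᵘ p ℚᵘ.< k ℚᵘ./ 1 → ℚ.floor (p ℚ.+ 1ℚ) ℤ.≤ k
floor[p+1]≤ p {k} p<k = subst (ℚ.floor (p ℚ.+ 1ℚ) ℤ.≤_) (ℤ.pred-suc k)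
  (ℤ.i<j⇒i≤pred[j] (floor<⇒ (p ℚ.+ 1ℚ) p+1<k+1))
  where
  k/1+1≃[k+1]/1 : k ℚᵘ./ 1 ℚᵘ.+ ℚᵘ.1ℚᵘ ℚᵘ.≃ ℤ.suc k ℚᵘ./ 1
  k/1+1≃[k+1]/1 = *≡* (normalise k)
    where
    normalise : ∀ k → (k ℤ.* + 1 ℤ.+ + 1 ℤ.* + 1) ℤ.* + 1 ≡ (+ 1 ℤ.+ k) ℤ.* + 1
    normalise = ℤSolver.solve-∀
  p+1<k+1 : toℚᵘ (p ℚ.+ 1ℚ) ℚᵘ.< ℤ.suc k ℚᵘ./ 1
  p+1<k+1 = ℚᵘ.<-respˡ-≃ (ℚᵘ.≃-sym (ℚ.toℚᵘ-homo-+ p 1ℚ))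
              (ℚᵘ.<-respʳ-≃ k/1+1≃[k+1]/1 (ℚᵘ.+-monoˡ-< ℚᵘ.1ℚᵘ p<k))

avgDeg<⇒ : ∀ {n} (G : Graph (suc n)) {k} → 2 ℕ.* numE G < k ℕ.* suc n → toℚᵘ (avgDeg G) ℚᵘ.< + k ℚᵘ./ 1
avgDeg<⇒ {n} G {k} 2m<kn = ℚᵘ.<-respˡ-≃ (ℚᵘ.≃-sym (ℚ.toℚᵘ-fromℚᵘ (+ (2 ℕ.* numE G) ℚᵘ./ suc n)))
  (*<* (subst₂ ℤ._<_ (sym (ℤ.*-identityʳ _)) (ℤ.pos-* k (suc n)) (+<+ 2m<kn)))

lemma3 : (n : ℕ) (G : Graph n) → Connected G →
         (k : ℤ) → IsFloorHalf3PlusSqrt (+ 9 ℤ.+ + 8 ℤ.* (+ numE G ℤ.- + numV G)) k →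
         ℚ.floor (avgDeg G ℚ.+ 1ℚ) ℤ.≤ k
-- k ≥ 1, because 0 < 2k - 1.
lemma3 _ _ _ (+ zero)   (_ , _ , () , _)
lemma3 _ _ _ ℤ.-[1+ _ ] (_ , _ , () , _)
lemma3 zero    G _ (+ suc t) _ = floor[p+1]≤ ℚ.0ℚ (*<* (+<+ z<s))
lemma3 (suc n) G _ (+ suc t) (0≤Δ , _ , _ , Δ<[2k-1]²) =
  floor[p+1]≤ (avgDeg G) (avgDeg<⇒ G 2m<[t+1]n)
  where
  2m<[t+1]n : 2 ℕ.* numE G < suc t ℕ.* suc n
  2m<[t+1]n = 2*m<[1+t]*n {numE G} {suc n} {t} z<s (0≤Δ⇒n≤1+m {numE G} 0≤Δ)
    (Δ<[2k-1]²⇒2*m+2<2*n+t*[1+t] {numE G} {suc n} {t} Δ<[2k-1]²) (2*numE+n≤n*n G)
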